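{- Let $n$, $k$, and $s$ be positive integers with $n \geq k$ and $n > s$. Then the maximum \[ \max_{U\subset V(C_n^s),\ |U|=k} e(U) \] is attained by any set of $k$ consecutive vertices of $C_n^s$ (i.e. any set of the form $\{a, a+1, \ldots, a+k-1\}$ modulo $n$).
   Context: $C_n$ denotes the cycle graph on vertex set $\mathbb{Z}/n\mathbb{Z}$, where $i$ and $i+1$ are adjacent. For a graph $G$, its $s$-th power $G^s$ has the same vertex set, with two distinct vertices adjacent iff their distance in $G$ is at most $s$. Thus in $C_n^s$, distinct $i,j\in\mathbb{Z}/n\mathbb{Z}$ are adjacent iff $\min(|i-j|, n-|i-j|)\le s$ (representing $i,j$ in $\{1,\dots,n\}$). For a vertex subset $U$, $e(U)$ denotes the number of edges of the induced subgraph on $U$. -}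

module Defs where

open import Data.Nat using (ℕ; zero; suc; _+_; _∸_; _≤_; _<_; _≤?_; _<?_; ∣_-_∣; _⊓_; NonZero)
open import Data.Nat.DivMod using (m%n<n)
open import Data.Fin using (Fin; toℕ; fromℕ<)
open import Data.Fin.Subset using (Subset; _∈_; ⁅_⁆; ⊥; _∪_)
open import Data.Fin.Subset.Properties using (_∈?_)
open import Data.List using (List; length; filter; allFin; concatMap; map; upTo; foldr)
open import Data.Product using (_×_; _,_; proj₁; proj₂)
open import Relation.Nullary using (Dec; yes; no; ¬_)
open import Relation.Nullary.Decidable using (_×-dec_)
open import Relation.Binary.PropositionalEquality using (_≡_)

cdist : (n : ℕ) → Fin n → Fin n → ℕ
cdist n i j = ∣ toℕ i - toℕ j ∣ ⊓ (n ∸ ∣ toℕ i - toℕ j ∣)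

EdgeIn : (n s : ℕ) → Subset n → Fin n × Fin n → Set
EdgeIn n s U (i , j) = ((toℕ i < toℕ j) × (cdist n i j ≤ s)) × (i ∈ U × j ∈ U)

EdgeIn? : (n s : ℕ) (U : Subset n) (p : Fin n × Fin n) → Dec (EdgeIn n s U p)
EdgeIn? n s U (i , j) =
  ((toℕ i <? toℕ j) ×-dec (cdist n i j ≤? s)) ×-dec ((i ∈? U) ×-dec (j ∈? U))

allPairs : (n : ℕ) → List (Fin n × Fin n)
allPairs n = concatMap (λ i → map (i ,_) (allFin n)) (allFin n)

-- e(U): number of edges of the subgraph of C_n^s induced on U
-- (each unordered edge {i,j} counted once, as the pair with toℕ i < toℕ j).
e : (n s : ℕ) → Subset n → ℕ
e n s U = length (filter (EdgeIn? n s U) (allPairs n))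

consec : (n : ℕ) .{{_ : NonZero n}} → Fin n → ℕ → Subset n
consec n a k =
  foldr (λ t S → ⁅ fromℕ< (m%n<n (toℕ a + t) n) ⁆ ∪ S) ⊥ (upTo k)

{-# OPTIONS --safe #-}
-- Write a subset U of ℤ/nℤ as its indicator χ on {0, …, n − 1}.  Counting ordered pairs,
-- 2·e(U) is the quadratic form Q(χ) = Σᵢ Σⱼ aᵢⱼ χᵢ χⱼ of the adjacency matrix a of C_n^s.
-- Rotations preserve Q, so every set {a, …, a + k − 1} has the value of the interval [0, k),
-- and it suffices to show Q(χ) ≤ Q([0, k)) whenever |χ| = k.  This goes by induction on n:
-- * if k ≤ s + 1 or n ≤ 2s + 1, then [0, k) is a clique; Q(χ) ≤ k(k − 1), with equality
--   for cliques;
-- * if 2s + 1 < n ≤ k + s, the graph is 2s-regular, so Q(χ) − Q(complement of χ) depends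
--   on k only, and the complement [k, n) of [0, k) is again a clique;
-- * otherwise some vertex lies outside χ: rotate it to n − 1 and delete it.  Circular
--   distances among the other vertices only shrink in C_{n−1}, so Q does not decrease,
--   while for [0, k) with k + s < n deleting n − 1 changes no adjacency.
module Submission where

open import Defs
open import Data.Nat
  using (ℕ; zero; suc; _+_; _*_; _∸_; _⊓_; ∣_-_∣; _≤_; _<_; _≤?_; _<?_; _≟_; z≤n; s≤s; s≤s⁻¹; z<s; NonZero)
open import Data.Nat.Properties
open import Data.Nat.DivMod
  using (_%_; m%n<n; m<n⇒m%n≡m; [m+n]%n≡m%n; %-distribˡ-+; m%n%n≡m%n; n%n≡0)
open import Algebra.Properties.CommutativeSemigroup +-commutativeSemigroup using (interchange)
open import Data.Bool using (Bool; true; false; not; _∧_)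
open import Data.Product using (_×_; _,_; ∃-syntax)
open import Data.Sum using (_⊎_; inj₁; inj₂)
open import Function using (_∘_; _⇔_; mk⇔)
open import Relation.Nullary using (Dec; yes; no; does; ¬_)
open import Relation.Nullary.Decidable using (dec-true; dec-false; does-⇔; _×-dec_)
open import Relation.Nullary.Negation using (contradiction)
open import Data.Fin as Fin using (Fin; toℕ; fromℕ<)
open import Data.Fin.Properties using (toℕ-fromℕ<; toℕ<n)
open import Data.Fin.Subset using (Subset; _∈_; ⁅_⁆; _∪_; ∣_∣) renaming (⊥ to ∅)
open import Data.Fin.Subset.Properties
  using (_∈?_; x∈⁅x⁆; x∈⁅y⁆⇒x≡y; x∈p∪q⁺; x∈p∪q⁻; ∉⊥)
open import Data.List
  using (List; []; _∷_; _++_; length; filter; map; concatMap; tabulate; allFin; foldr; applyUpTo)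
open import Data.List.Properties using (filter-++; length-++; map-tabulate)
open import Data.List.Relation.Unary.Any using (Any; here; there)
open import Data.List.Relation.Unary.Any.Properties using (applyUpTo⁺; applyUpTo⁻)
open import Data.Vec using ([]; _∷_)
open import Level using (0ℓ)
open import Relation.Unary using (Pred; Decidable)
open import Relation.Binary.Definitions using (tri<; tri≈; tri>)
open import Relation.Binary.PropositionalEquality
  using (_≡_; _≢_; refl; sym; trans; cong; cong₂; subst; module ≡-Reasoning)

-- Finite sums over {0, …, n − 1}

∑ : ℕ → (ℕ → ℕ) → ℕ
∑ zero    f = 0
∑ (suc n) f = ∑ n f + f n

infixl 10 ∑
syntax ∑ n (λ i → e) = ∑[ i < n ] e

∑-cong : ∀ n {f g : ℕ → ℕ} → (∀ {i} → i < n → f i ≡ g i) → ∑ n f ≡ ∑ n g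
∑-cong zero    f≗g = refl
∑-cong (suc n) f≗g = cong₂ _+_ (∑-cong n (λ i<n → f≗g (m<n⇒m<1+n i<n))) (f≗g (n<1+n n))

∑-mono-≤ : ∀ n {f g : ℕ → ℕ} → (∀ {i} → i < n → f i ≤ g i) → ∑ n f ≤ ∑ n g
∑-mono-≤ zero    f≤g = z≤n
∑-mono-≤ (suc n) f≤g = +-mono-≤ (∑-mono-≤ n (λ i<n → f≤g (m<n⇒m<1+n i<n))) (f≤g (n<1+n n))

∑-const : ∀ n c → ∑[ i < n ] c ≡ n * c
∑-const zero    c = refl
∑-const (suc n) c = trans (cong (_+ c) (∑-const n c)) (+-comm (n * c) c)

∑-cong-const : ∀ n c {f : ℕ → ℕ} → (∀ {i} → i < n → f i ≡ c) → ∑ n f ≡ n * c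
∑-cong-const n c f≗c = trans (∑-cong n f≗c) (∑-const n c)

∑-zero : ∀ n {f : ℕ → ℕ} → (∀ {i} → i < n → f i ≡ 0) → ∑ n f ≡ 0
∑-zero n f≗0 = trans (∑-cong-const n 0 f≗0) (*-zeroʳ n)

∑-distrib-+ : ∀ n (f g : ℕ → ℕ) → ∑[ i < n ] (f i + g i) ≡ ∑ n f + ∑ n g
∑-distrib-+ zero    f g = refl
∑-distrib-+ (suc n) f g =
  trans (cong (_+ (f n + g n)) (∑-distrib-+ n f g)) (interchange (∑ n f) (∑ n g) (f n) (g n))

*-distribˡ-∑ : ∀ n c (f : ℕ → ℕ) → c * ∑ n f ≡ ∑[ i < n ] (c * f i)
*-distribˡ-∑ zero    c f = *-zeroʳ c
*-distribˡ-∑ (suc n) c f =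
  trans (*-distribˡ-+ c (∑ n f) (f n)) (cong (_+ c * f n) (*-distribˡ-∑ n c f))

*-distribʳ-∑ : ∀ n c (f : ℕ → ℕ) → ∑ n f * c ≡ ∑[ i < n ] (f i * c)
*-distribʳ-∑ zero    c f = refl
*-distribʳ-∑ (suc n) c f =
  trans (*-distribʳ-+ c (∑ n f) (f n)) (cong (_+ f n * c) (*-distribʳ-∑ n c f))

∑-comm : ∀ m n (f : ℕ → ℕ → ℕ) →
         ∑[ i < m ] ∑[ j < n ] f i j ≡ ∑[ j < n ] ∑[ i < m ] f i j
∑-comm zero    n f = sym (∑-zero n (λ _ → refl))
∑-comm (suc m) n f =
  trans (cong (_+ ∑ n (f m)) (∑-comm m n f)) (sym (∑-distrib-+ n (λ j → ∑[ i < m ] f i j) (f m)))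

∑-suc : ∀ n (f : ℕ → ℕ) → ∑ (suc n) f ≡ f 0 + ∑[ i < n ] f (suc i)
∑-suc zero    f = +-comm 0 (f 0)
∑-suc (suc n) f = trans (cong (_+ f (suc n)) (∑-suc n f)) (+-assoc (f 0) _ (f (suc n)))

∑-+ : ∀ m n (f : ℕ → ℕ) → ∑ (m + n) f ≡ ∑ m f + ∑[ i < n ] f (m + i)
∑-+ m zero    f = trans (cong (λ k → ∑ k f) (+-identityʳ m)) (sym (+-identityʳ (∑ m f)))
∑-+ m (suc n) f = begin
  ∑ (m + suc n) f                             ≡⟨ cong (λ k → ∑ k f) (+-suc m n) ⟩
  ∑ (m + n) f + f (m + n)                     ≡⟨ cong (_+ f (m + n)) (∑-+ m n f) ⟩
  ∑ m f + ∑[ i < n ] f (m + i) + f (m + n)    ≡⟨ +-assoc (∑ m f) _ _ ⟩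
  ∑ m f + ∑[ i < suc n ] f (m + i)            ∎
  where open ≡-Reasoning

∑∑-distrib-+ : ∀ m n (f g : ℕ → ℕ → ℕ) →
               ∑[ i < m ] ∑[ j < n ] (f i j + g i j)
                 ≡ ∑[ i < m ] ∑[ j < n ] f i j + ∑[ i < m ] ∑[ j < n ] g i j
∑∑-distrib-+ m n f g = trans (∑-cong m (λ {i} _ → ∑-distrib-+ n (f i) (g i)))
                             (∑-distrib-+ m (λ i → ∑ n (f i)) (λ i → ∑ n (g i)))

-- Quadratic forms of weight matrices

𝟙 : Bool → ℕ
𝟙 true  = 1
𝟙 false = 0

𝟙-idem : ∀ b → 𝟙 b * 𝟙 b ≡ 𝟙 b
𝟙-idem true  = refl
𝟙-idem false = refl

𝟙-∧ : ∀ a b → 𝟙 (a ∧ b) ≡ 𝟙 a * 𝟙 b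
𝟙-∧ true  b = sym (+-identityʳ (𝟙 b))
𝟙-∧ false b = refl

δ : ℕ → ℕ → ℕ
δ i j = 𝟙 (does (i ≟ j))

δ-refl : ∀ i → δ i i ≡ 1
δ-refl i = cong 𝟙 (dec-true (i ≟ i) refl)

δ-≢ : ∀ {i j} → i ≢ j → δ i j ≡ 0
δ-≢ {i} {j} i≢j = cong 𝟙 (dec-false (i ≟ j) i≢j)

∑-δ : ∀ n {i} (g : ℕ → ℕ) → i < n → ∑[ j < n ] (δ i j * g j) ≡ g i
∑-δ (suc n) g i<1+n with m≤n⇒m<n∨m≡n (s≤s⁻¹ i<1+n)
... | inj₁ i<n  = trans (cong₂ _+_ (∑-δ n g i<n) (cong (_* g n) (δ-≢ (<⇒≢ i<n)))) (+-identityʳ _)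
... | inj₂ refl = cong₂ _+_ (∑-zero n (λ j<n → cong (_* g _) (δ-≢ (>⇒≢ j<n))))
                            (trans (cong (_* g n) (δ-refl n)) (*-identityˡ (g n)))

count : ℕ → (ℕ → Bool) → ℕ
count n χ = ∑[ i < n ] 𝟙 (χ i)

quadForm : ℕ → (ℕ → ℕ → ℕ) → (ℕ → Bool) → ℕ
quadForm n w χ = ∑[ i < n ] ∑[ j < n ] (w i j * (𝟙 (χ i) * 𝟙 (χ j)))

count-cong : ∀ n {χ χ′ : ℕ → Bool} → (∀ {i} → i < n → χ i ≡ χ′ i) →
             count n χ ≡ count n χ′
count-cong n χ≗χ′ = ∑-cong n (cong 𝟙 ∘ χ≗χ′)

quadForm-cong : ∀ n w {χ χ′ : ℕ → Bool} → (∀ {i} → i < n → χ i ≡ χ′ i) →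
                quadForm n w χ ≡ quadForm n w χ′
quadForm-cong n w χ≗χ′ = ∑-cong n (λ i<n → ∑-cong n (λ j<n →
  cong₂ (λ x y → w _ _ * (𝟙 x * 𝟙 y)) (χ≗χ′ i<n) (χ≗χ′ j<n)))

count-complement : ∀ n (χ : ℕ → Bool) → count n χ + count n (not ∘ χ) ≡ n
count-complement n χ = begin
  count n χ + count n (not ∘ χ)         ≡⟨ ∑-distrib-+ n (𝟙 ∘ χ) (𝟙 ∘ not ∘ χ) ⟨
  ∑[ i < n ] (𝟙 (χ i) + 𝟙 (not (χ i)))  ≡⟨ ∑-cong-const n 1 (λ {i} _ → 𝟙+𝟙-not (χ i)) ⟩
  n * 1                                 ≡⟨ *-identityʳ n ⟩
  n                                     ∎
  where
  open ≡-Reasoning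
  𝟙+𝟙-not : ∀ b → 𝟙 b + 𝟙 (not b) ≡ 1
  𝟙+𝟙-not true  = refl
  𝟙+𝟙-not false = refl

count-complement-cong : ∀ n {χ χ′ : ℕ → Bool} → count n χ ≡ count n χ′ →
                        count n (not ∘ χ) ≡ count n (not ∘ χ′)
count-complement-cong n {χ} {χ′} same-count = +-cancelˡ-≡ (count n χ) _ _ (begin
  count n χ + count n (not ∘ χ)    ≡⟨ count-complement n χ ⟩
  n                                ≡⟨ count-complement n χ′ ⟨
  count n χ′ + count n (not ∘ χ′)  ≡⟨ cong (_+ count n (not ∘ χ′)) same-count ⟨
  count n χ + count n (not ∘ χ′)   ∎)
  where open ≡-Reasoning

count-suc : ∀ m (χ : ℕ → Bool) → χ m ≡ false → count (suc m) χ ≡ count m χ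
count-suc m χ χm = trans (cong (λ b → count m χ + 𝟙 b) χm) (+-identityʳ (count m χ))

∑∑𝟙𝟙≡count² : ∀ n (χ : ℕ → Bool) →
               ∑[ i < n ] ∑[ j < n ] (𝟙 (χ i) * 𝟙 (χ j)) ≡ count n χ * count n χ
∑∑𝟙𝟙≡count² n χ = begin
  ∑[ i < n ] ∑[ j < n ] (𝟙 (χ i) * 𝟙 (χ j))
    ≡⟨ ∑-cong n (λ {i} _ → *-distribˡ-∑ n (𝟙 (χ i)) (𝟙 ∘ χ)) ⟨
  ∑[ i < n ] (𝟙 (χ i) * count n χ)
    ≡⟨ *-distribʳ-∑ n (count n χ) (𝟙 ∘ χ) ⟨
  count n χ * count n χ
    ∎
  where open ≡-Reasoning

quadForm-+-count : ∀ n w χ → quadForm n w χ + count n χ ≡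
                   ∑[ i < n ] ∑[ j < n ] ((w i j + δ i j) * (𝟙 (χ i) * 𝟙 (χ j)))
quadForm-+-count n w χ = begin
  quadForm n w χ + count n χ
    ≡⟨ cong (quadForm n w χ +_) (∑-cong n diagonal) ⟨
  quadForm n w χ + ∑[ i < n ] ∑[ j < n ] (δ i j * x i j)
    ≡⟨ ∑∑-distrib-+ n n (λ i j → w i j * x i j) (λ i j → δ i j * x i j) ⟨
  ∑[ i < n ] ∑[ j < n ] (w i j * x i j + δ i j * x i j)
    ≡⟨ ∑-cong n (λ {i} _ → ∑-cong n (λ {j} _ → *-distribʳ-+ (x i j) (w i j) (δ i j))) ⟨
  ∑[ i < n ] ∑[ j < n ] ((w i j + δ i j) * x i j)
    ∎
  where
  open ≡-Reasoning
  x : ℕ → ℕ → ℕ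
  x i j = 𝟙 (χ i) * 𝟙 (χ j)
  diagonal : ∀ {i} → i < n → ∑[ j < n ] (δ i j * x i j) ≡ 𝟙 (χ i)
  diagonal {i} i<n = trans (∑-δ n (x i) i<n) (𝟙-idem (χ i))

Clique : ℕ → (ℕ → ℕ → ℕ) → (ℕ → Bool) → Set
Clique n w χ = ∀ {i j} → i < n → j < n → i ≢ j → χ i ≡ true → χ j ≡ true → w i j ≡ 1

module _ (n : ℕ) (w : ℕ → ℕ → ℕ) (w-loopless : ∀ i → w i i ≡ 0) where

  quadForm-+-count≤count² : (w≤1 : ∀ i j → w i j ≤ 1) (χ : ℕ → Bool) →
                            quadForm n w χ + count n χ ≤ count n χ * count n χ
  quadForm-+-count≤count² w≤1 χ = begin
    quadForm n w χ + count n χ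
      ≡⟨ quadForm-+-count n w χ ⟩
    ∑[ i < n ] ∑[ j < n ] ((w i j + δ i j) * (𝟙 (χ i) * 𝟙 (χ j)))
      ≤⟨ ∑-mono-≤ n (λ {i} _ → ∑-mono-≤ n (λ {j} _ → term≤ i j)) ⟩
    ∑[ i < n ] ∑[ j < n ] (𝟙 (χ i) * 𝟙 (χ j))
      ≡⟨ ∑∑𝟙𝟙≡count² n χ ⟩
    count n χ * count n χ
      ∎
    where
    open ≤-Reasoning
    w+δ≤1 : ∀ i j → w i j + δ i j ≤ 1
    w+δ≤1 i j with i ≟ j
    ... | yes refl = ≤-reflexive (cong₂ _+_ (w-loopless i) (δ-refl i))
    ... | no i≢j   = subst (_≤ 1) (trans (sym (+-identityʳ (w i j))) (cong (w i j +_) (sym (δ-≢ i≢j)))) (w≤1 i j)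
    term≤ : ∀ i j → (w i j + δ i j) * (𝟙 (χ i) * 𝟙 (χ j)) ≤ 𝟙 (χ i) * 𝟙 (χ j)
    term≤ i j = ≤-trans (*-monoˡ-≤ _ (w+δ≤1 i j)) (≤-reflexive (*-identityˡ _))

  quadForm-+-count≡count² : (χ : ℕ → Bool) → Clique n w χ →
                            quadForm n w χ + count n χ ≡ count n χ * count n χ
  quadForm-+-count≡count² χ clique = begin
    quadForm n w χ + count n χ
      ≡⟨ quadForm-+-count n w χ ⟩
    ∑[ i < n ] ∑[ j < n ] ((w i j + δ i j) * (𝟙 (χ i) * 𝟙 (χ j)))
      ≡⟨ ∑-cong n (λ i<n → ∑-cong n (λ j<n → term≡ i<n j<n)) ⟩
    ∑[ i < n ] ∑[ j < n ] (𝟙 (χ i) * 𝟙 (χ j))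
      ≡⟨ ∑∑𝟙𝟙≡count² n χ ⟩
    count n χ * count n χ
      ∎
    where
    open ≡-Reasoning
    w+δ≡1 : ∀ {i j} → i < n → j < n → χ i ≡ true → χ j ≡ true → w i j + δ i j ≡ 1
    w+δ≡1 {i} {j} i<n j<n χi χj with i ≟ j
    ... | yes refl = cong₂ _+_ (w-loopless i) (δ-refl i)
    ... | no i≢j   = cong₂ _+_ (clique i<n j<n i≢j χi χj) (δ-≢ i≢j)
    term≡ : ∀ {i j} → i < n → j < n →
            (w i j + δ i j) * (𝟙 (χ i) * 𝟙 (χ j)) ≡ 𝟙 (χ i) * 𝟙 (χ j)
    term≡ {i} {j} i<n j<n with χ i in χi | χ j in χj
    ... | true  | true  = cong (_* 1) (w+δ≡1 i<n j<n χi χj)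
    ... | true  | false = *-zeroʳ (w i j + δ i j)
    ... | false | _     = *-zeroʳ (w i j + δ i j)

  quadForm-≤-clique : (w≤1 : ∀ i j → w i j ≤ 1) {χ χ′ : ℕ → Bool} →
                      count n χ ≡ count n χ′ → Clique n w χ′ → quadForm n w χ ≤ quadForm n w χ′
  quadForm-≤-clique w≤1 {χ} {χ′} same-count clique = +-cancelʳ-≤ (count n χ′) _ _ (begin
    quadForm n w χ + count n χ′   ≡⟨ cong (quadForm n w χ +_) same-count ⟨
    quadForm n w χ + count n χ    ≤⟨ quadForm-+-count≤count² w≤1 χ ⟩
    count n χ * count n χ         ≡⟨ cong (λ c → c * c) same-count ⟩
    count n χ′ * count n χ′       ≡⟨ quadForm-+-count≡count² χ′ clique ⟨
    quadForm n w χ′ + count n χ′  ∎)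
    where open ≤-Reasoning

quadForm-monoʷ-≤ : ∀ n (w w′ : ℕ → ℕ → ℕ) (χ : ℕ → Bool) →
                   (∀ {i j} → i < n → j < n → χ i ≡ true → χ j ≡ true → w i j ≤ w′ i j) →
                   quadForm n w χ ≤ quadForm n w′ χ
quadForm-monoʷ-≤ n w w′ χ w≤w′ = ∑-mono-≤ n (λ i<n → ∑-mono-≤ n (λ j<n → term≤ i<n j<n))
  where
  term≤ : ∀ {i j} → i < n → j < n →
          w i j * (𝟙 (χ i) * 𝟙 (χ j)) ≤ w′ i j * (𝟙 (χ i) * 𝟙 (χ j))
  term≤ {i} {j} i<n j<n with χ i in χi | χ j in χj
  ... | true  | true  = *-monoˡ-≤ 1 (w≤w′ i<n j<n χi χj)
  ... | true  | false = ≤-reflexive (trans (*-zeroʳ (w i j)) (sym (*-zeroʳ (w′ i j))))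
  ... | false | _     = ≤-reflexive (trans (*-zeroʳ (w i j)) (sym (*-zeroʳ (w′ i j))))

quadForm-suc : ∀ m w (χ : ℕ → Bool) → χ m ≡ false → quadForm (suc m) w χ ≡ quadForm m w χ
quadForm-suc m w χ χm = begin
  ∑[ i < m ] (∑[ j < m ] term i j + term i m) + ∑[ j < suc m ] term m j
    ≡⟨ cong₂ _+_ (∑-cong m (λ {i} _ → trans (cong (∑ m (term i) +_) (term-m i)) (+-identityʳ _)))
                 (∑-zero (suc m) (λ {j} _ → term-m′ j)) ⟩
  quadForm m w χ + 0
    ≡⟨ +-identityʳ _ ⟩
  quadForm m w χ
    ∎
  where
  open ≡-Reasoning
  term : ℕ → ℕ → ℕ
  term i j = w i j * (𝟙 (χ i) * 𝟙 (χ j))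
  term-m : ∀ i → term i m ≡ 0
  term-m i rewrite χm = trans (cong (w i m *_) (*-zeroʳ (𝟙 (χ i)))) (*-zeroʳ (w i m))
  term-m′ : ∀ j → term m j ≡ 0
  term-m′ j rewrite χm = *-zeroʳ (w m j)

module _ (n d : ℕ) (w : ℕ → ℕ → ℕ) (w-sym : ∀ i j → w i j ≡ w j i)
         (w-regular : ∀ {i} → i < n → ∑[ j < n ] w i j ≡ d) where

  private
    ∑∑w·g≡d·∑g : ∀ (w′ : ℕ → ℕ → ℕ) → (∀ {i} → i < n → ∑[ j < n ] w′ i j ≡ d) → ∀ g →
                 ∑[ i < n ] ∑[ j < n ] (w′ i j * g i) ≡ d * ∑ n g
    ∑∑w·g≡d·∑g w′ regular g = begin
      ∑[ i < n ] ∑[ j < n ] (w′ i j * g i)  ≡⟨ ∑-cong n (λ {i} _ → *-distribʳ-∑ n (g i) (w′ i)) ⟨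
      ∑[ i < n ] (∑ n (w′ i) * g i)         ≡⟨ ∑-cong n (λ {i} i<n → cong (_* g i) (regular i<n)) ⟩
      ∑[ i < n ] (d * g i)                  ≡⟨ *-distribˡ-∑ n d g ⟨
      d * ∑ n g                             ∎
      where open ≡-Reasoning

  quadForm-complement : ∀ χ →
                        quadForm n w χ + (d + d) * count n (not ∘ χ) ≡ n * d + quadForm n w (not ∘ χ)
  quadForm-complement χ = begin
    quadForm n w χ + (d + d) * count n (not ∘ χ)
      ≡⟨ cong (quadForm n w χ +_) (*-distribʳ-+ (count n (not ∘ χ)) d d) ⟩
    quadForm n w χ + (d * count n (not ∘ χ) + d * count n (not ∘ χ))
      ≡⟨ cong (λ t → quadForm n w χ + (t + d * count n (not ∘ χ))) rows ⟨
    quadForm n w χ + (∑[ i < n ] ∑[ j < n ] (w i j * x̄ i) + d * count n (not ∘ χ))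
      ≡⟨ cong (λ t → quadForm n w χ + (∑[ i < n ] ∑[ j < n ] (w i j * x̄ i) + t)) columns ⟨
    quadForm n w χ + (∑[ i < n ] ∑[ j < n ] (w i j * x̄ i) + ∑[ i < n ] ∑[ j < n ] (w i j * x̄ j))
      ≡⟨ cong (quadForm n w χ +_) (∑∑-distrib-+ n n _ _) ⟨
    quadForm n w χ + ∑[ i < n ] ∑[ j < n ] (w i j * x̄ i + w i j * x̄ j)
      ≡⟨ ∑∑-distrib-+ n n _ _ ⟨
    ∑[ i < n ] ∑[ j < n ] (w i j * (x i * x j) + (w i j * x̄ i + w i j * x̄ j))
      ≡⟨ ∑-cong n (λ {i} _ → ∑-cong n (λ {j} _ → pointwise (w i j) (χ i) (χ j))) ⟩
    ∑[ i < n ] ∑[ j < n ] (w i j + w i j * (x̄ i * x̄ j))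
      ≡⟨ ∑∑-distrib-+ n n _ _ ⟩
    ∑[ i < n ] ∑[ j < n ] w i j + quadForm n w (not ∘ χ)
      ≡⟨ cong (_+ quadForm n w (not ∘ χ)) (∑-cong-const n d w-regular) ⟩
    n * d + quadForm n w (not ∘ χ)
      ∎
    where
    open ≡-Reasoning
    x x̄ : ℕ → ℕ
    x  i = 𝟙 (χ i)
    x̄ i = 𝟙 (not (χ i))
    rows : ∑[ i < n ] ∑[ j < n ] (w i j * x̄ i) ≡ d * count n (not ∘ χ)
    rows = ∑∑w·g≡d·∑g w w-regular x̄
    columns : ∑[ i < n ] ∑[ j < n ] (w i j * x̄ j) ≡ d * count n (not ∘ χ)
    columns = trans (∑-comm n n (λ i j → w i j * x̄ j)) (∑∑w·g≡d·∑g (λ j i → w i j) w-regularᵀ x̄)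
      where
      w-regularᵀ : ∀ {j} → j < n → ∑[ i < n ] w i j ≡ d
      w-regularᵀ {j} j<n = trans (∑-cong n (λ {i} _ → w-sym i j)) (w-regular j<n)
    𝟙-identity : ∀ a b → 𝟙 a * 𝟙 b + (𝟙 (not a) + 𝟙 (not b)) ≡ 1 + 𝟙 (not a) * 𝟙 (not b)
    𝟙-identity true  true  = refl
    𝟙-identity true  false = refl
    𝟙-identity false true  = refl
    𝟙-identity false false = refl
    pointwise : ∀ c a b → c * (𝟙 a * 𝟙 b) + (c * 𝟙 (not a) + c * 𝟙 (not b))
                            ≡ c + c * (𝟙 (not a) * 𝟙 (not b))
    pointwise c a b = begin
      c * (𝟙 a * 𝟙 b) + (c * 𝟙 (not a) + c * 𝟙 (not b))  ≡⟨ cong (c * (𝟙 a * 𝟙 b) +_) (*-distribˡ-+ c _ _) ⟨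
      c * (𝟙 a * 𝟙 b) + c * (𝟙 (not a) + 𝟙 (not b))      ≡⟨ *-distribˡ-+ c _ _ ⟨
      c * (𝟙 a * 𝟙 b + (𝟙 (not a) + 𝟙 (not b)))          ≡⟨ cong (c *_) (𝟙-identity a b) ⟩
      c * (1 + 𝟙 (not a) * 𝟙 (not b))                    ≡⟨ *-distribˡ-+ c 1 _ ⟩
      c * 1 + c * (𝟙 (not a) * 𝟙 (not b))                ≡⟨ cong (_+ c * (𝟙 (not a) * 𝟙 (not b))) (*-identityʳ c) ⟩
      c + c * (𝟙 (not a) * 𝟙 (not b))                    ∎

  quadForm-≤-by-complement : ∀ {χ χ′} → count n χ ≡ count n χ′ →
                             quadForm n w (not ∘ χ) ≤ quadForm n w (not ∘ χ′) →
                             quadForm n w χ ≤ quadForm n w χ′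
  quadForm-≤-by-complement {χ} {χ′} same-count complements≤ = +-cancelʳ-≤ X _ _ (begin
    quadForm n w χ + X                              ≡⟨ quadForm-complement χ ⟩
    n * d + quadForm n w (not ∘ χ)                  ≤⟨ +-monoʳ-≤ (n * d) complements≤ ⟩
    n * d + quadForm n w (not ∘ χ′)                 ≡⟨ quadForm-complement χ′ ⟨
    quadForm n w χ′ + (d + d) * count n (not ∘ χ′)  ≡⟨ cong (λ c → quadForm n w χ′ + (d + d) * c) same-complement ⟨
    quadForm n w χ′ + X                             ∎)
    where
    open ≤-Reasoning
    X = (d + d) * count n (not ∘ χ)
    same-complement = count-complement-cong n same-count

-- Rotations of ℤ/nℤ

rotate : (n : ℕ) .{{_ : NonZero n}} → ℕ → ℕ → ℕ
rotate n r i = (r + i) % n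

module _ (m : ℕ) where

  private
    n = suc m

  rotate-< : ∀ r i → rotate n r i < n
  rotate-< r i = m%n<n (r + i) n

  rotate-zero : ∀ {i} → i < n → rotate n 0 i ≡ i
  rotate-zero = m<n⇒m%n≡m

  rotate-rotate : ∀ r r′ i → rotate n r (rotate n r′ i) ≡ rotate n (r + r′) i
  rotate-rotate r r′ i = begin
    (r + (r′ + i) % n) % n              ≡⟨ %-distribˡ-+ r ((r′ + i) % n) n ⟩
    (r % n + (r′ + i) % n % n) % n      ≡⟨ cong (λ x → (r % n + x) % n) (m%n%n≡m%n (r′ + i) n) ⟩
    (r % n + (r′ + i) % n) % n          ≡⟨ %-distribˡ-+ r (r′ + i) n ⟨
    (r + (r′ + i)) % n                  ≡⟨ cong (_% n) (+-assoc r r′ i) ⟨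
    (r + r′ + i) % n                    ∎
    where open ≡-Reasoning

  rotate-suc : ∀ r i → rotate n (suc r) i ≡ suc (rotate n r i) % n
  rotate-suc r i = sym (rotate-rotate 1 r i)

  rotate-injective : ∀ r {i j} → r ≤ n → i < n → j < n → rotate n r i ≡ rotate n r j → i ≡ j
  rotate-injective r {i} {j} r≤n i<n j<n ρi≡ρj = begin
    i                                 ≡⟨ undo i<n ⟨
    rotate n (n ∸ r) (rotate n r i)   ≡⟨ cong (rotate n (n ∸ r)) ρi≡ρj ⟩
    rotate n (n ∸ r) (rotate n r j)   ≡⟨ undo j<n ⟩
    j                                 ∎
    where
    open ≡-Reasoning
    undo : ∀ {t} → t < n → rotate n (n ∸ r) (rotate n r t) ≡ t
    undo {t} t<n = begin
      rotate n (n ∸ r) (rotate n r t)   ≡⟨ rotate-rotate (n ∸ r) r t ⟩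
      (n ∸ r + r + t) % n               ≡⟨ cong (λ x → (x + t) % n) (m∸n+n≡m r≤n) ⟩
      (n + t) % n                       ≡⟨ cong (_% n) (+-comm n t) ⟩
      (t + n) % n                       ≡⟨ [m+n]%n≡m%n t n ⟩
      t % n                             ≡⟨ m<n⇒m%n≡m t<n ⟩
      t                                 ∎

  step-< : ∀ {i} → i < m → suc i % n ≡ suc i
  step-< i<m = m<n⇒m%n≡m (s≤s i<m)

  step-last : suc m % n ≡ 0
  step-last = n%n≡0 n

  ∑-rotate : ∀ r (f : ℕ → ℕ) → ∑[ i < n ] f (rotate n r i) ≡ ∑ n f
  ∑-rotate zero    f = ∑-cong n (λ i<n → cong f (rotate-zero i<n))
  ∑-rotate (suc r) f = begin
    ∑[ i < n ] f (rotate n (suc r) i)       ≡⟨ ∑-cong n (λ {i} _ → cong f (rotate-suc r i)) ⟩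
    ∑[ i < n ] f (suc (rotate n r i) % n)   ≡⟨ ∑-rotate r (λ i → f (suc i % n)) ⟩
    ∑[ i < n ] f (suc i % n)                ≡⟨ cong₂ _+_ (∑-cong m (cong f ∘ step-<)) (cong f step-last) ⟩
    ∑[ i < m ] f (suc i) + f 0              ≡⟨ +-comm _ (f 0) ⟩
    f 0 + ∑[ i < m ] f (suc i)              ≡⟨ ∑-suc m f ⟨
    ∑ n f                                   ∎
    where open ≡-Reasoning

  count-rotate : ∀ r (χ : ℕ → Bool) → count n (χ ∘ rotate n r) ≡ count n χ
  count-rotate r χ = ∑-rotate r (𝟙 ∘ χ)

  quadForm-rotate : ∀ r w (χ : ℕ → Bool) →
                    (∀ {i j} → i < n → j < n → w (rotate n r i) (rotate n r j) ≡ w i j) →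
                    quadForm n w (χ ∘ rotate n r) ≡ quadForm n w χ
  quadForm-rotate r w χ w-invariant = begin
    ∑[ i < n ] ∑[ j < n ] (w i j * (x (ρ i) * x (ρ j)))
      ≡⟨ ∑-cong n (λ {i} i<n → ∑-cong n (λ {j} j<n → cong (_* (x (ρ i) * x (ρ j))) (w-invariant i<n j<n))) ⟨
    ∑[ i < n ] ∑[ j < n ] (w (ρ i) (ρ j) * (x (ρ i) * x (ρ j)))
      ≡⟨ ∑-cong n (λ {i} _ → ∑-rotate r (λ j → w (ρ i) j * (x (ρ i) * x j))) ⟩
    ∑[ i < n ] ∑[ j < n ] (w (ρ i) j * (x (ρ i) * x j))
      ≡⟨ ∑-rotate r (λ i → ∑[ j < n ] (w i j * (x i * x j))) ⟩
    quadForm n w χ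
      ∎
    where
    open ≡-Reasoning
    ρ = rotate n r
    x = 𝟙 ∘ χ

-- Circular distance and the graph C_n^s

dist : ℕ → ℕ → ℕ → ℕ
dist n i j = ∣ i - j ∣ ⊓ (n ∸ ∣ i - j ∣)

dist-sym : ∀ n i j → dist n i j ≡ dist n j i
dist-sym n i j = cong (λ d → d ⊓ (n ∸ d)) (∣-∣-comm i j)

dist-self : ∀ n i → dist n i i ≡ 0
dist-self n i = cong (λ d → d ⊓ (n ∸ d)) (∣n-n∣≡0 i)

dist≤∣-∣ : ∀ n i j → dist n i j ≤ ∣ i - j ∣
dist≤∣-∣ n i j = m⊓n≤m _ _

dist-suc : ∀ n i j → dist n i j ≤ dist (suc n) i j
dist-suc n i j = ⊓-monoʳ-≤ ∣ i - j ∣ (∸-monoˡ-≤ ∣ i - j ∣ (n≤1+n n))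

dist+dist≤n : ∀ n i j → ∣ i - j ∣ ≤ n → dist n i j + dist n i j ≤ n
dist+dist≤n n i j ∣i-j∣≤n =
  ≤-trans (+-mono-≤ (m⊓n≤m ∣ i - j ∣ (n ∸ ∣ i - j ∣)) (m⊓n≤n ∣ i - j ∣ (n ∸ ∣ i - j ∣)))
          (≤-reflexive (m+[n∸m]≡n ∣i-j∣≤n))

∣-∣<∸ : ∀ {a b i j} → a ≤ i → a ≤ j → i < b → j < b → ∣ i - j ∣ < b ∸ a
∣-∣<∸ {a} {b} {i} {j} a≤i a≤j i<b j<b with ∣m-n∣≡[m∸n]∨[n∸m] i j
... | inj₁ ∣i-j∣≡i∸j = subst (_< b ∸ a) (sym ∣i-j∣≡i∸j) (≤-<-trans (∸-monoʳ-≤ i a≤j) (∸-monoˡ-< i<b a≤i))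
... | inj₂ ∣i-j∣≡j∸i = subst (_< b ∸ a) (sym ∣i-j∣≡j∸i) (≤-<-trans (∸-monoʳ-≤ j a≤i) (∸-monoˡ-< j<b a≤j))

dist-pos : ∀ {n i j} → i ≢ j → ∣ i - j ∣ < n → 0 < dist n i j
dist-pos i≢j ∣i-j∣<n = ⊓-glb (n≢0⇒n>0 (i≢j ∘ ∣m-n∣≡0⇒m≡n)) (m<n⇒0<n∸m ∣i-j∣<n)

dist-pos⇒≢ : ∀ {n i j} → 0 < dist n i j → i ≢ j
dist-pos⇒≢ {n} {i} 0<dist refl = <-irrefl (sym (dist-self n i)) 0<dist

module _ (m : ℕ) where

  private
    n = suc m

  dist-wrap : ∀ {j} → j < m → dist n 0 (suc j) ≡ dist n m j
  dist-wrap {j} j<m = begin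
    suc j ⊓ (m ∸ j)                ≡⟨ ⊓-comm (suc j) (m ∸ j) ⟩
    (m ∸ j) ⊓ suc j                ≡⟨ cong ((m ∸ j) ⊓_) n∸[m∸j]≡1+j ⟨
    (m ∸ j) ⊓ (n ∸ (m ∸ j))        ≡⟨ cong (λ d → d ⊓ (n ∸ d)) (m≤n⇒∣n-m∣≡n∸m (<⇒≤ j<m)) ⟨
    dist n m j                     ∎
    where
    open ≡-Reasoning
    n∸[m∸j]≡1+j : n ∸ (m ∸ j) ≡ suc j
    n∸[m∸j]≡1+j = trans (+-∸-assoc 1 (m∸n≤m m j)) (cong suc (m∸[m∸n]≡n (<⇒≤ j<m)))

  dist-step : ∀ {i j} → i < n → j < n → dist n (suc i % n) (suc j % n) ≡ dist n i j
  dist-step i<n j<n with m≤n⇒m<n∨m≡n (s≤s⁻¹ i<n) | m≤n⇒m<n∨m≡n (s≤s⁻¹ j<n)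
  ... | inj₁ i<m | inj₁ j<m rewrite step-< m i<m | step-< m j<m = refl
  ... | inj₁ i<m | inj₂ refl rewrite step-< m i<m | step-last m =
    trans (dist-sym n _ 0) (trans (dist-wrap i<m) (dist-sym n m _))
  ... | inj₂ refl | inj₁ j<m rewrite step-< m j<m | step-last m = dist-wrap j<m
  ... | inj₂ refl | inj₂ refl rewrite step-last m = sym (dist-self n m)

  dist-rotate : ∀ r {i j} → i < n → j < n → dist n (rotate n r i) (rotate n r j) ≡ dist n i j
  dist-rotate zero    i<n j<n rewrite rotate-zero m i<n | rotate-zero m j<n = refl
  dist-rotate (suc r) {i} {j} i<n j<n rewrite rotate-suc m r i | rotate-suc m r j =
    trans (dist-step (rotate-< m r i) (rotate-< m r j)) (dist-rotate r i<n j<n)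

Near : ℕ → ℕ → Set
Near s d = 0 < d × d ≤ s

near? : ∀ s d → Dec (Near s d)
near? s d = (0 <? d) ×-dec (d ≤? s)

adjᵈ : ℕ → ℕ → ℕ
adjᵈ s d = 𝟙 (does (near? s d))

adj : ℕ → ℕ → ℕ → ℕ → ℕ
adj n s i j = adjᵈ s (dist n i j)

adj-sym : ∀ n s i j → adj n s i j ≡ adj n s j i
adj-sym n s i j = cong (adjᵈ s) (dist-sym n i j)

adj-loopless : ∀ n s i → adj n s i i ≡ 0
adj-loopless n s i = cong (adjᵈ s) (dist-self n i)

adj≤1 : ∀ n s i j → adj n s i j ≤ 1
adj≤1 n s i j with does (near? s (dist n i j))
... | true  = ≤-refl
... | false = z≤n

adjᵈ≡1 : ∀ {s d} → Near s d → adjᵈ s d ≡ 1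
adjᵈ≡1 {s} {d} near = cong 𝟙 (dec-true (near? s d) near)

adjᵈ≡0 : ∀ {s d} → ¬ Near s d → adjᵈ s d ≡ 0
adjᵈ≡0 {s} {d} ¬near = cong 𝟙 (dec-false (near? s d) ¬near)

adj-mono : ∀ {n n′ s i j} → (Near s (dist n i j) → Near s (dist n′ i j)) →
           adj n s i j ≤ adj n′ s i j
adj-mono {n} {n′} {s} {i} {j} near⇒near′ with near? s (dist n i j)
... | yes near = ≤-reflexive (trans (adjᵈ≡1 near) (sym (adjᵈ≡1 (near⇒near′ near))))
... | no ¬near = subst (_≤ adj n′ s i j) (sym (adjᵈ≡0 ¬near)) z≤n

adj-rotate : ∀ m s r {i j} → i < suc m → j < suc m →
             adj (suc m) s (rotate (suc m) r i) (rotate (suc m) r j) ≡ adj (suc m) s i j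
adj-rotate m s r i<n j<n = cong (adjᵈ s) (dist-rotate m r i<n j<n)

near-⊓ : ∀ {s x y} → 0 < x → 0 < y → x ≤ s ⊎ y ≤ s → Near s (x ⊓ y)
near-⊓ {x = x} {y} 0<x 0<y (inj₁ x≤s) = ⊓-glb 0<x 0<y , ≤-trans (m⊓n≤m x y) x≤s
near-⊓ {x = x} {y} 0<x 0<y (inj₂ y≤s) = ⊓-glb 0<x 0<y , ≤-trans (m⊓n≤n x y) y≤s

far-⊓ : ∀ {s x y} → s < x → s < y → ¬ Near s (x ⊓ y)
far-⊓ s<x s<y (_ , x⊓y≤s) = <⇒≱ (⊓-glb s<x s<y) x⊓y≤s

-- Writing n = 1 + s + t + s, the neighbours of 0 are 1, …, s and 1 + s + t, …, n − 1.
adj-degree-0 : ∀ s t → let n = suc (s + (t + s)) in ∑[ j < n ] adj n s 0 j ≡ s + s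
adj-degree-0 s t = begin
  ∑[ j < n ] f j
    ≡⟨ ∑-suc (s + (t + s)) f ⟩
  f 0 + ∑[ j < s + (t + s) ] f (suc j)
    ≡⟨ ∑-+ s (t + s) (f ∘ suc) ⟩
  ∑[ i < s ] f (suc i) + ∑[ i < t + s ] f (suc (s + i))
    ≡⟨ cong (∑[ i < s ] f (suc i) +_) (∑-+ t s (λ i → f (suc (s + i)))) ⟩
  ∑[ i < s ] f (suc i) + (∑[ i < t ] f (suc (s + i)) + ∑[ i < s ] f (suc (s + (t + i))))
    ≡⟨ cong₂ _+_ (∑-cong-const s 1 near-left) (cong₂ _+_ (∑-zero t far) (∑-cong-const s 1 near-right)) ⟩
  s * 1 + s * 1
    ≡⟨ cong (λ x → x + x) (*-identityʳ s) ⟩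
  s + s
    ∎
  where
  open ≡-Reasoning
  n = suc (s + (t + s))
  f = adj n s 0
  near-left : ∀ {i} → i < s → f (suc i) ≡ 1
  near-left {i} i<s =
    adjᵈ≡1 (near-⊓ z<s (m<n⇒0<n∸m (s≤s (≤-trans i<s (m≤m+n s (t + s))))) (inj₁ i<s))
  far : ∀ {i} → i < t → f (suc (s + i)) ≡ 0
  far {i} i<t =
    adjᵈ≡0 (far-⊓ (s≤s (m≤m+n s i)) (subst (s <_) (sym n∸j≡[t∸i]+s) (m<n+m s (m<n⇒0<n∸m i<t))))
    where
    n∸j≡[t∸i]+s : n ∸ suc (s + i) ≡ (t ∸ i) + s
    n∸j≡[t∸i]+s = trans ([m+n]∸[m+o]≡n∸o s (t + s) i) (+-∸-comm s (<⇒≤ i<t))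
  near-right : ∀ {i} → i < s → f (suc (s + (t + i))) ≡ 1
  near-right {i} i<s = adjᵈ≡1 (near-⊓ z<s (subst (0 <_) (sym n∸j≡s∸i) (m<n⇒0<n∸m i<s))
                                           (inj₂ (≤-trans (≤-reflexive n∸j≡s∸i) (m∸n≤m s i))))
    where
    n∸j≡s∸i : n ∸ suc (s + (t + i)) ≡ s ∸ i
    n∸j≡s∸i = trans ([m+n]∸[m+o]≡n∸o s (t + s) (t + i)) ([m+n]∸[m+o]≡n∸o t s i)

adj-regular : ∀ n s → s + s < n → ∀ {i} → i < n → ∑[ j < n ] adj n s i j ≡ s + s
adj-regular n@(suc m) s 2s<n {i} i<n = begin
  ∑[ j < n ] adj n s i j               ≡⟨ ∑-rotate m i (adj n s i) ⟨
  ∑[ j < n ] adj n s i (rotate n i j)  ≡⟨ ∑-cong n (λ {j} j<n →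
                                            trans (cong (λ x → adj n s x (rotate n i j)) (sym rotate-i-0))
                                                  (adj-rotate m s i z<s j<n)) ⟩
  ∑[ j < n ] adj n s 0 j               ≡⟨ degree-0 ⟩
  s + s                                ∎
  where
  open ≡-Reasoning
  rotate-i-0 : rotate n i 0 ≡ i
  rotate-i-0 = trans (cong (_% n) (+-identityʳ i)) (m<n⇒m%n≡m i<n)
  degree-0 : ∑[ j < n ] adj n s 0 j ≡ s + s
  degree-0 with t , refl ← m≤n⇒∃[o]m+o≡n 2s<n =
    subst (λ k → ∑[ j < suc k ] adj (suc k) s 0 j ≡ s + s) s+[t+s]≡s+s+t (adj-degree-0 s t)
    where
    s+[t+s]≡s+s+t : s + (t + s) ≡ s + s + t
    s+[t+s]≡s+s+t = trans (cong (s +_) (+-comm t s)) (sym (+-assoc s s t))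

adj-clique : ∀ n s (χ : ℕ → Bool) →
             (∀ {i j} → i < n → j < n → χ i ≡ true → χ j ≡ true → dist n i j ≤ s) → Clique n (adj n s) χ
adj-clique n s χ close i<n j<n i≢j χi χj =
  adjᵈ≡1 (dist-pos i≢j (∣-∣<∸ z≤n z≤n i<n j<n) , close i<n j<n χi χj)

interval-clique : ∀ n s {a b} (χ : ℕ → Bool) → b ∸ a ≤ suc s →
                  (∀ {i} → i < n → χ i ≡ true → a ≤ i × i < b) → Clique n (adj n s) χ
interval-clique n s {a} {b} χ short inside = adj-clique n s χ close
  where
  close : ∀ {i j} → i < n → j < n → χ i ≡ true → χ j ≡ true → dist n i j ≤ s
  close {i} {j} i<n j<n χi χj with inside i<n χi | inside j<n χj
  ... | a≤i , i<b | a≤j , j<b = s≤s⁻¹ (<-≤-trans (≤-<-trans (dist≤∣-∣ n i j) (∣-∣<∸ a≤i a≤j i<b j<b)) short)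

complete-clique : ∀ n s (χ : ℕ → Bool) → n ≤ suc (s + s) → Clique n (adj n s) χ
complete-clique n s χ n≤1+2s = adj-clique n s χ close
  where
  half : ∀ {c} → c + c ≤ suc (s + s) → c ≤ s
  half c+c≤1+2s = ≮⇒≥ (λ s<c → 1+n≰n (subst (_≤ suc (s + s)) (cong suc (+-suc s s))
                                              (≤-trans (+-mono-≤ s<c s<c) c+c≤1+2s)))
  close : ∀ {i j} → i < n → j < n → χ i ≡ true → χ j ≡ true → dist n i j ≤ s
  close {i} {j} i<n j<n _ _ = half (≤-trans (dist+dist≤n n i j (<⇒≤ (∣-∣<∸ z≤n z≤n i<n j<n))) n≤1+2s)

near-restrict : ∀ {m s i j} → i < m → j < m → Near s (dist (suc m) i j) → Near s (dist m i j)
near-restrict {m} {s} {i} {j} i<m j<m (0<d , d≤s) =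
  dist-pos {m} {i} {j} (dist-pos⇒≢ {suc m} 0<d) (∣-∣<∸ z≤n z≤n i<m j<m) , ≤-trans (dist-suc m i j) d≤s

near-extend : ∀ {m s i j} → ∣ i - j ∣ + s < m → Near s (dist m i j) → Near s (dist (suc m) i j)
near-extend {m} {s} {i} {j} short (0<d , d≤s) =
  dist-pos {suc m} {i} {j} (dist-pos⇒≢ {m} 0<d) (m<n⇒m<1+n (≤-<-trans (m≤m+n _ s) short)) ,
  ≤-trans (dist≤∣-∣ (suc m) i j) ∣i-j∣≤s
  where
  s<m∸∣i-j∣ : s < m ∸ ∣ i - j ∣
  s<m∸∣i-j∣ = m+n≤o⇒m≤o∸n (suc s) (subst (_≤ m) (cong suc (+-comm ∣ i - j ∣ s)) short)
  ∣i-j∣≤s : ∣ i - j ∣ ≤ s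
  ∣i-j∣≤s = ≮⇒≥ (λ s<∣i-j∣ → far-⊓ s<∣i-j∣ s<m∸∣i-j∣ (0<d , d≤s))

-- Initial intervals are extremal

initial : ℕ → ℕ → Bool
initial k i = does (i <? k)

initial-< : ∀ {k i} → initial k i ≡ true → i < k
initial-< {k} {i} χi with i <? k
... | yes i<k = i<k
... | no  i≮k = contradiction (trans (sym χi) (dec-false (i <? k) i≮k)) (λ ())

not-initial-≥ : ∀ {k i} → not (initial k i) ≡ true → k ≤ i
not-initial-≥ {k} {i} χ̄i =
  ≮⇒≥ (λ i<k → contradiction (trans (sym (cong not (dec-true (i <? k) i<k))) χ̄i) (λ ()))

count-initial : ∀ {n k} → k ≤ n → count n (initial k) ≡ k
count-initial {n} {k} k≤n = begin
  count n (initial k)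
    ≡⟨ cong (λ l → count l (initial k)) (m+[n∸m]≡n k≤n) ⟨
  count (k + (n ∸ k)) (initial k)
    ≡⟨ ∑-+ k (n ∸ k) (𝟙 ∘ initial k) ⟩
  count k (initial k) + ∑[ i < n ∸ k ] 𝟙 (initial k (k + i))
    ≡⟨ cong₂ _+_ (∑-cong-const k 1 inside) (∑-zero (n ∸ k) outside) ⟩
  k * 1 + 0
    ≡⟨ trans (+-identityʳ (k * 1)) (*-identityʳ k) ⟩
  k
    ∎
  where
  open ≡-Reasoning
  inside : ∀ {i} → i < k → 𝟙 (initial k i) ≡ 1
  inside {i} i<k = cong 𝟙 (dec-true (i <? k) i<k)
  outside : ∀ {i} → i < n ∸ k → 𝟙 (initial k (k + i)) ≡ 0
  outside {i} _ = cong 𝟙 (dec-false (k + i <? k) (≤⇒≯ (m≤m+n k i)))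

quadForm-delete : ∀ m s (χ : ℕ → Bool) → χ m ≡ false →
                  quadForm (suc m) (adj (suc m) s) χ ≤ quadForm m (adj m s) χ
quadForm-delete m s χ χm = begin
  quadForm (suc m) (adj (suc m) s) χ
    ≡⟨ quadForm-suc m (adj (suc m) s) χ χm ⟩
  quadForm m (adj (suc m) s) χ
    ≤⟨ quadForm-monoʷ-≤ m (adj (suc m) s) (adj m s) χ (λ i<m j<m _ _ → restrict i<m j<m) ⟩
  quadForm m (adj m s) χ
    ∎
  where
  open ≤-Reasoning
  restrict : ∀ {i j} → i < m → j < m → adj (suc m) s i j ≤ adj m s i j
  restrict {i} {j} i<m j<m = adj-mono {suc m} {m} {s} {i} {j} (near-restrict i<m j<m)

quadForm-initial-extend : ∀ m s {k} → k + s ≤ m →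
                          quadForm m (adj m s) (initial k) ≤ quadForm (suc m) (adj (suc m) s) (initial k)
quadForm-initial-extend m s {k} k+s≤m = begin
  quadForm m (adj m s) (initial k)
    ≤⟨ quadForm-monoʷ-≤ m (adj m s) (adj (suc m) s) (initial k) (λ _ _ → extend) ⟩
  quadForm m (adj (suc m) s) (initial k)
    ≡⟨ quadForm-suc m (adj (suc m) s) (initial k) (dec-false (m <? k) (≤⇒≯ k≤m)) ⟨
  quadForm (suc m) (adj (suc m) s) (initial k)
    ∎
  where
  open ≤-Reasoning
  k≤m = ≤-trans (m≤m+n k s) k+s≤m
  extend : ∀ {i j} → initial k i ≡ true → initial k j ≡ true → adj m s i j ≤ adj (suc m) s i j
  extend {i} {j} χi χj = adj-mono {m} {suc m} {s} {i} {j} (near-extend {m} {s} {i} {j}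
    (<-≤-trans (+-monoˡ-< s (∣-∣<∸ z≤n z≤n (initial-< χi) (initial-< χj))) k+s≤m))

∃-outside : ∀ n (χ : ℕ → Bool) → count n χ < n → ∃[ y ] y < n × χ y ≡ false
∃-outside (suc n) χ |χ|<1+n with χ n in χn
... | false = n , n<1+n n , χn
... | true  with ∃-outside n χ (subst (_≤ n) (+-comm (count n χ) 1) (s≤s⁻¹ |χ|<1+n))
...   | y , y<n , χy = y , m<n⇒m<1+n y<n , χy

rotate-gap-to-last : ∀ m s (χ : ℕ → Bool) → count (suc m) χ < suc m →
                     ∃[ χ′ ] χ′ m ≡ false × count (suc m) χ′ ≡ count (suc m) χ
                             × quadForm (suc m) (adj (suc m) s) χ′ ≡ quadForm (suc m) (adj (suc m) s) χ
rotate-gap-to-last m s χ |χ|<n with ∃-outside (suc m) χ |χ|<n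
... | y , y<n , χy = χ ∘ rotate n (suc y) , trans (cong χ rotate-m≡y) χy , count-rotate m (suc y) χ ,
                     quadForm-rotate m (suc y) (adj n s) χ (adj-rotate m s (suc y))
  where
  n = suc m
  rotate-m≡y : rotate n (suc y) m ≡ y
  rotate-m≡y = trans (cong (_% n) (sym (+-suc y m))) (trans ([m+n]%n≡m%n y n) (m<n⇒m%n≡m y<n))

quadForm-≤-initial : ∀ s n {k} (χ : ℕ → Bool) → count n χ ≡ k → k ≤ n →
                     quadForm n (adj n s) χ ≤ quadForm n (adj n s) (initial k)
quadForm-≤-initial s zero    χ _ _ = z≤n
quadForm-≤-initial s (suc m) {k} χ |χ|≡k k≤n = cases
  where
  n = suc m
  same-count : count n χ ≡ count n (initial k)
  same-count = trans |χ|≡k (sym (count-initial k≤n))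
  ≤-clique : ∀ {χ χ′} → count n χ ≡ count n χ′ → Clique n (adj n s) χ′ →
             quadForm n (adj n s) χ ≤ quadForm n (adj n s) χ′
  ≤-clique = quadForm-≤-clique n (adj n s) (adj-loopless n s) (adj≤1 n s)
  cases : quadForm n (adj n s) χ ≤ quadForm n (adj n s) (initial k)
  cases with k ≤? suc s | n ≤? suc (s + s) | n ≤? k + s
  ... | yes k≤1+s | _ | _ =
    ≤-clique same-count (interval-clique n s (initial k) k≤1+s (λ _ χi → z≤n , initial-< χi))
  ... | no _ | yes n≤1+2s | _ =
    ≤-clique same-count (complete-clique n s (initial k) n≤1+2s)
  ... | no _ | no n≰1+2s | yes n≤k+s =
    quadForm-≤-by-complement n (s + s) (adj n s) (adj-sym n s) (adj-regular n s 2s<n) same-count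
      (≤-clique (count-complement-cong n same-count) complement-clique)
    where
    2s<n = <⇒≤ (≰⇒> n≰1+2s)
    complement-clique : Clique n (adj n s) (not ∘ initial k)
    complement-clique = interval-clique n s {k} (not ∘ initial k) (m≤n⇒m≤1+n (m≤n+o⇒m∸n≤o n k n≤k+s))
                                        (λ i<n χ̄i → not-initial-≥ χ̄i , i<n)
  ... | no _ | no _ | no n≰k+s
    with rotate-gap-to-last m s χ (subst (_< n) (sym |χ|≡k) (≤-<-trans (m≤m+n k s) (≰⇒> n≰k+s)))
  ...   | χ′ , χ′m , |χ′|≡|χ| , Qχ′≡Qχ = begin
    quadForm n (adj n s) χ            ≡⟨ Qχ′≡Qχ ⟨
    quadForm n (adj n s) χ′           ≤⟨ quadForm-delete m s χ′ χ′m ⟩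
    quadForm m (adj m s) χ′           ≤⟨ quadForm-≤-initial s m χ′ |χ′|≡k k≤m ⟩
    quadForm m (adj m s) (initial k)  ≤⟨ quadForm-initial-extend m s k+s≤m ⟩
    quadForm n (adj n s) (initial k)  ∎
    where
    open ≤-Reasoning
    k+s≤m = s≤s⁻¹ (≰⇒> n≰k+s)
    k≤m = ≤-trans (m≤m+n k s) k+s≤m
    |χ′|≡k = trans (sym (count-suc m χ′ χ′m)) (trans |χ′|≡|χ| |χ|≡k)

-- Subsets of Fin n

indicator : ∀ {n} → Subset n → ℕ → Bool
indicator []      _       = false
indicator (b ∷ U) zero    = b
indicator (b ∷ U) (suc i) = indicator U i

∈?-indicator : ∀ {n} (x : Fin n) (U : Subset n) → does (x ∈? U) ≡ indicator U (toℕ x)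
∈?-indicator Fin.zero    (true  ∷ U) = refl
∈?-indicator Fin.zero    (false ∷ U) = refl
∈?-indicator (Fin.suc x) (b ∷ U)     = ∈?-indicator x U

∣U∣≡count : ∀ {n} (U : Subset n) → ∣ U ∣ ≡ count n (indicator U)
∣U∣≡count []              = refl
∣U∣≡count {suc n} (b ∷ U) = trans (head+tail b) (sym (∑-suc n (𝟙 ∘ indicator (b ∷ U))))
  where
  head+tail : ∀ b → ∣ b ∷ U ∣ ≡ 𝟙 b + count n (indicator U)
  head+tail true  = cong suc (∣U∣≡count U)
  head+tail false = ∣U∣≡count U

module _ {A : Set} {P : Pred A 0ℓ} (P? : Decidable P) where

  length-filter-∷ : ∀ x xs → length (filter P? (x ∷ xs)) ≡ 𝟙 (does (P? x)) + length (filter P? xs)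
  length-filter-∷ x xs with does (P? x)
  ... | true  = refl
  ... | false = refl

  length-filter-tabulate : ∀ n (f : Fin n → A) (c : ℕ → ℕ) → (∀ x → 𝟙 (does (P? (f x))) ≡ c (toℕ x)) →
                           length (filter P? (tabulate f)) ≡ ∑ n c
  length-filter-tabulate zero    f c f≗c = refl
  length-filter-tabulate (suc n) f c f≗c = begin
    length (filter P? (tabulate f))
      ≡⟨ length-filter-∷ (f Fin.zero) (tabulate (f ∘ Fin.suc)) ⟩
    𝟙 (does (P? (f Fin.zero))) + length (filter P? (tabulate (f ∘ Fin.suc)))
      ≡⟨ cong₂ _+_ (f≗c Fin.zero) (length-filter-tabulate n (f ∘ Fin.suc) (c ∘ suc) (f≗c ∘ Fin.suc)) ⟩
    c 0 + ∑[ i < n ] c (suc i)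
      ≡⟨ ∑-suc n c ⟨
    ∑ (suc n) c
      ∎
    where open ≡-Reasoning

  length-filter-concatMap-tabulate : ∀ {B : Set} n (f : Fin n → B) (g : B → List A) (c : ℕ → ℕ) →
                                     (∀ x → length (filter P? (g (f x))) ≡ c (toℕ x)) →
                                     length (filter P? (concatMap g (tabulate f))) ≡ ∑ n c
  length-filter-concatMap-tabulate zero    f g c f≗c = refl
  length-filter-concatMap-tabulate (suc n) f g c f≗c = begin
    length (filter P? (g (f Fin.zero) ++ concatMap g (tabulate (f ∘ Fin.suc))))
      ≡⟨ cong length (filter-++ P? (g (f Fin.zero)) _) ⟩
    length (filter P? (g (f Fin.zero)) ++ filter P? (concatMap g (tabulate (f ∘ Fin.suc))))
      ≡⟨ length-++ (filter P? (g (f Fin.zero))) ⟩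
    length (filter P? (g (f Fin.zero))) + length (filter P? (concatMap g (tabulate (f ∘ Fin.suc))))
      ≡⟨ cong₂ _+_ (f≗c Fin.zero) (length-filter-concatMap-tabulate n (f ∘ Fin.suc) g (c ∘ suc) (f≗c ∘ Fin.suc)) ⟩
    c 0 + ∑[ i < n ] c (suc i)
      ≡⟨ ∑-suc n c ⟨
    ∑ (suc n) c
      ∎
    where open ≡-Reasoning

edge< : ℕ → ℕ → (ℕ → Bool) → ℕ → ℕ → ℕ
edge< n s χ i j = 𝟙 (does (i <? j)) * 𝟙 (does (dist n i j ≤? s)) * (𝟙 (χ i) * 𝟙 (χ j))

𝟙-EdgeIn? : ∀ n s (U : Subset n) (x y : Fin n) →
            𝟙 (does (EdgeIn? n s U (x , y))) ≡ edge< n s (indicator U) (toℕ x) (toℕ y)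
𝟙-EdgeIn? n s U x y = begin
  𝟙 ((a ∧ b) ∧ (does (x ∈? U) ∧ does (y ∈? U)))
    ≡⟨ 𝟙-∧ (a ∧ b) _ ⟩
  𝟙 (a ∧ b) * 𝟙 (does (x ∈? U) ∧ does (y ∈? U))
    ≡⟨ cong₂ _*_ (𝟙-∧ a b) (𝟙-∧ (does (x ∈? U)) (does (y ∈? U))) ⟩
  𝟙 a * 𝟙 b * (𝟙 (does (x ∈? U)) * 𝟙 (does (y ∈? U)))
    ≡⟨ cong₂ (λ u v → 𝟙 a * 𝟙 b * (𝟙 u * 𝟙 v)) (∈?-indicator x U) (∈?-indicator y U) ⟩
  edge< n s (indicator U) (toℕ x) (toℕ y)
    ∎
  where
  open ≡-Reasoning
  a = does (toℕ x <? toℕ y)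
  b = does (cdist n x y ≤? s)

e≡∑∑edge< : ∀ n s (U : Subset n) → e n s U ≡ ∑[ i < n ] ∑[ j < n ] edge< n s (indicator U) i j
e≡∑∑edge< n s U =
  length-filter-concatMap-tabulate (EdgeIn? n s U) n (λ x → x) (λ x → map (x ,_) (allFin n)) _ row
  where
  row : ∀ x → length (filter (EdgeIn? n s U) (map (x ,_) (allFin n)))
                ≡ ∑[ j < n ] edge< n s (indicator U) (toℕ x) j
  row x = trans (cong (length ∘ filter (EdgeIn? n s U)) (map-tabulate (λ y → y) (x ,_)))
                (length-filter-tabulate (EdgeIn? n s U) n (x ,_) _ (𝟙-EdgeIn? n s U x))

module _ (n s : ℕ) (χ : ℕ → Bool) where

  edge<-pair : ∀ {i j} → i < n → j < n → i < j →
               edge< n s χ i j + edge< n s χ j i ≡ adj n s i j * (𝟙 (χ i) * 𝟙 (χ j))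
  edge<-pair {i} {j} i<n j<n i<j = begin
    𝟙 (does (i <? j)) * D * X + 𝟙 (does (j <? i)) * D′ * X′
      ≡⟨ cong₂ _+_ (cong (λ b → 𝟙 b * D * X) (dec-true (i <? j) i<j))
                   (cong (λ b → 𝟙 b * D′ * X′) (dec-false (j <? i) (<⇒≯ i<j))) ⟩
    1 * D * X + 0
      ≡⟨ trans (+-identityʳ _) (cong (_* X) (*-identityˡ D)) ⟩
    D * X
      ≡⟨ cong (λ b → 𝟙 (b ∧ does (dist n i j ≤? s)) * X) 0<dist ⟨
    adj n s i j * X
      ∎
    where
    open ≡-Reasoning
    D = 𝟙 (does (dist n i j ≤? s))
    X = 𝟙 (χ i) * 𝟙 (χ j)
    D′ = 𝟙 (does (dist n j i ≤? s))
    X′ = 𝟙 (χ j) * 𝟙 (χ i)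
    0<dist : does (0 <? dist n i j) ≡ true
    0<dist = dec-true (0 <? dist n i j) (dist-pos (<⇒≢ i<j) (∣-∣<∸ z≤n z≤n i<n j<n))

  edge<-symmetrise : ∀ {i j} → i < n → j < n →
                     edge< n s χ i j + edge< n s χ j i ≡ adj n s i j * (𝟙 (χ i) * 𝟙 (χ j))
  edge<-symmetrise {i} {j} i<n j<n with <-cmp i j
  ... | tri< i<j _ _ = edge<-pair i<n j<n i<j
  ... | tri> _ _ j<i = begin
    edge< n s χ i j + edge< n s χ j i       ≡⟨ +-comm (edge< n s χ i j) _ ⟩
    edge< n s χ j i + edge< n s χ i j       ≡⟨ edge<-pair j<n i<n j<i ⟩
    adj n s j i * (𝟙 (χ j) * 𝟙 (χ i))       ≡⟨ cong₂ _*_ (adj-sym n s j i) (*-comm (𝟙 (χ j)) (𝟙 (χ i))) ⟩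
    adj n s i j * (𝟙 (χ i) * 𝟙 (χ j))       ∎
    where open ≡-Reasoning
  ... | tri≈ _ refl _ = begin
    edge< n s χ i i + edge< n s χ i i       ≡⟨ cong₂ _+_ edge<-diagonal edge<-diagonal ⟩
    0                                       ≡⟨ cong (_* (𝟙 (χ i) * 𝟙 (χ i))) (adj-loopless n s i) ⟨
    adj n s i i * (𝟙 (χ i) * 𝟙 (χ i))       ∎
    where
    open ≡-Reasoning
    edge<-diagonal : edge< n s χ i i ≡ 0
    edge<-diagonal = cong (λ b → 𝟙 b * 𝟙 (does (dist n i i ≤? s)) * (𝟙 (χ i) * 𝟙 (χ i)))
                          (dec-false (i <? i) (<-irrefl refl))

e+e≡quadForm : ∀ n s (U : Subset n) → e n s U + e n s U ≡ quadForm n (adj n s) (indicator U)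
e+e≡quadForm n s U = begin
  e n s U + e n s U
    ≡⟨ cong₂ _+_ (e≡∑∑edge< n s U) (trans (e≡∑∑edge< n s U) (∑-comm n n (edge< n s χ))) ⟩
  ∑[ i < n ] ∑[ j < n ] edge< n s χ i j + ∑[ i < n ] ∑[ j < n ] edge< n s χ j i
    ≡⟨ ∑∑-distrib-+ n n (edge< n s χ) (λ i j → edge< n s χ j i) ⟨
  ∑[ i < n ] ∑[ j < n ] (edge< n s χ i j + edge< n s χ j i)
    ≡⟨ ∑-cong n (λ i<n → ∑-cong n (λ j<n → edge<-symmetrise n s χ i<n j<n)) ⟩
  quadForm n (adj n s) χ
    ∎
  where
  open ≡-Reasoning
  χ = indicator U

module _ {n : ℕ} (f : ℕ → Fin n) where

  ∈-foldr-⁅⁆∪⁺ : ∀ {x} ts → Any (λ t → x ≡ f t) ts → x ∈ foldr (λ t S → ⁅ f t ⁆ ∪ S) ∅ ts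
  ∈-foldr-⁅⁆∪⁺ (t ∷ ts) (here refl)  = x∈p∪q⁺ (inj₁ (x∈⁅x⁆ (f t)))
  ∈-foldr-⁅⁆∪⁺ (t ∷ ts) (there x∈ts) = x∈p∪q⁺ (inj₂ (∈-foldr-⁅⁆∪⁺ ts x∈ts))

  ∈-foldr-⁅⁆∪⁻ : ∀ {x} ts → x ∈ foldr (λ t S → ⁅ f t ⁆ ∪ S) ∅ ts → Any (λ t → x ≡ f t) ts
  ∈-foldr-⁅⁆∪⁻ []       x∈∅ = contradiction x∈∅ ∉⊥
  ∈-foldr-⁅⁆∪⁻ (t ∷ ts) x∈S with x∈p∪q⁻ ⁅ f t ⁆ _ x∈S
  ... | inj₁ x∈⁅ft⁆ = here (x∈⁅y⁆⇒x≡y (f t) x∈⁅ft⁆)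
  ... | inj₂ x∈rest = there (∈-foldr-⁅⁆∪⁻ ts x∈rest)

module _ (m : ℕ) (a : Fin (suc m)) {k : ℕ} (k≤n : k ≤ suc m) where

  private
    n = suc m
    C = consec n a k
    point : ℕ → Fin n
    point t = fromℕ< (rotate-< m (toℕ a) t)

  point∈consec⇔ : ∀ {i} → i < n → point i ∈ C ⇔ i < k
  point∈consec⇔ {i} i<n = mk⇔ to from
    where
    to : point i ∈ C → i < k
    to i∈C with applyUpTo⁻ (λ t → t) (∈-foldr-⁅⁆∪⁻ point (applyUpTo (λ t → t) k) i∈C)
    ... | t , t<k , pi≡pt = subst (_< k) (sym i≡t) t<k
      where
      i≡t : i ≡ t
      i≡t = rotate-injective m (toℕ a) (<⇒≤ (toℕ<n a)) i<n (<-≤-trans t<k k≤n) (begin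
        rotate n (toℕ a) i   ≡⟨ toℕ-fromℕ< (rotate-< m (toℕ a) i) ⟨
        toℕ (point i)        ≡⟨ cong toℕ pi≡pt ⟩
        toℕ (point t)        ≡⟨ toℕ-fromℕ< (rotate-< m (toℕ a) t) ⟩
        rotate n (toℕ a) t   ∎)
        where open ≡-Reasoning
    from : i < k → point i ∈ C
    from i<k = ∈-foldr-⁅⁆∪⁺ point (applyUpTo (λ t → t) k) (applyUpTo⁺ (λ t → t) refl i<k)

  consec-rotate : ∀ {i} → i < n → indicator C (rotate n (toℕ a) i) ≡ initial k i
  consec-rotate {i} i<n = begin
    indicator C (rotate n (toℕ a) i)  ≡⟨ cong (indicator C) (toℕ-fromℕ< (rotate-< m (toℕ a) i)) ⟨
    indicator C (toℕ (point i))       ≡⟨ ∈?-indicator (point i) C ⟨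
    does (point i ∈? C)               ≡⟨ does-⇔ (point∈consec⇔ i<n) (point i ∈? C) (i <? k) ⟩
    initial k i                       ∎
    where open ≡-Reasoning

  count-consec : count n (indicator C) ≡ k
  count-consec = begin
    count n (indicator C)                      ≡⟨ count-rotate m (toℕ a) (indicator C) ⟨
    count n (indicator C ∘ rotate n (toℕ a))   ≡⟨ count-cong n consec-rotate ⟩
    count n (initial k)                        ≡⟨ count-initial k≤n ⟩
    k                                          ∎
    where open ≡-Reasoning

  quadForm-consec : ∀ s → quadForm n (adj n s) (indicator C) ≡ quadForm n (adj n s) (initial k)
  quadForm-consec s = begin
    quadForm n (adj n s) (indicator C)
      ≡⟨ quadForm-rotate m (toℕ a) (adj n s) (indicator C) (adj-rotate m s (toℕ a)) ⟨
    quadForm n (adj n s) (indicator C ∘ rotate n (toℕ a))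
      ≡⟨ quadForm-cong n (adj n s) consec-rotate ⟩
    quadForm n (adj n s) (initial k)
      ∎
    where open ≡-Reasoning

theorem1 : (n k s : ℕ) .{{_ : NonZero n}} → 0 < k → 0 < s → k ≤ n → s < n →
    (a : Fin n) →
      (∣ consec n a k ∣ ≡ k) ×
      ((U : Subset n) → ∣ U ∣ ≡ k → e n s U ≤ e n s (consec n a k))
theorem1 n@(suc m) k s _ _ k≤n _ a = trans (∣U∣≡count C) (count-consec m a k≤n) , e-bound
  where
  C = consec n a k
  e-bound : (U : Subset n) → ∣ U ∣ ≡ k → e n s U ≤ e n s C
  e-bound U ∣U∣≡k = ≮⇒≥ λ eC<eU → <⇒≱ (+-mono-< eC<eU eC<eU) (begin
    e n s U + e n s U                    ≡⟨ e+e≡quadForm n s U ⟩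
    quadForm n (adj n s) (indicator U)   ≤⟨ quadForm-≤-initial s n (indicator U) ∣χU∣≡k k≤n ⟩
    quadForm n (adj n s) (initial k)     ≡⟨ quadForm-consec m a k≤n s ⟨
    quadForm n (adj n s) (indicator C)   ≡⟨ e+e≡quadForm n s C ⟨
    e n s C + e n s C                    ∎)
    where
    open ≤-Reasoning
    ∣χU∣≡k = trans (sym (∣U∣≡count U)) ∣U∣≡k
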